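{- Let $n\geqslant 1$ and $V=\{v_1,\dots,v_n\}$. The layered e-adjacency tensor determines the hypergraph: if $\mathcal{H}=(V,E)$ and $\mathcal{H}'=(V,E')$ are hypergraphs on the same labeled vertex set $V$ whose layered e-adjacency tensors $\mathcal{A}_{\mathcal{H}}$ and $\mathcal{A}_{\mathcal{H}'}$ are equal (in particular of the same order and dimension), then $E=E'$. Equivalently, given $n$ and the tensor $\mathcal{A}_{\mathcal{H}}$, the hypergraph $\mathcal{H}$ is uniquely determined (up to the labeling of its vertices).
   Context: A hypergraph $\mathcal{H}=(V,E)$ has a finite vertex set $V=\{v_1,\dots,v_n\}$ and a nonempty set $E$ of nonempty subsets of $V$; $k_{\max}=\max_{e\in E}|e|$. The layered e-adjacency tensor $\mathcal{A}_{\mathcal{H}}$ is the real tensor of order $k_{\max}$ and dimension $n+k_{\max}-1$ (indices range over $\{1,\dots,n+k_{\max}-1\}$; index $n+j$ corresponds to an additional vertex $y_j$, $1\leqslant j\leqslant k_{\max}-1$) defined as follows: for each hyperedge $e=\{v_{i_1},\dots,v_{i_s}\}\in E$ with $s=|e|$, every entry whose index tuple is a permutation of the $k_{\max}$-tuple $(i_1,\dots,i_s,n+s,n+s+1,\dots,n+k_{\max}-1)$ equals $\frac{1}{(k_{\max}-1)!}$; all other entries are $0$. -}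

module Defs where

open import Data.Nat using (ℕ; zero; suc; _+_; _∸_; _⊔_; _!)
open import Data.Nat.Properties using (_!≢0)
open import Data.Fin using (Fin; toℕ)
open import Data.Fin.Subset using (Subset; ∣_∣; Nonempty)
open import Data.Fin.Subset.Properties using (_∈?_)
open import Data.List using (List; []; _∷_; map; filter; allFin; applyUpTo; _++_; foldr)
open import Data.List.Relation.Unary.All using (All)
open import Data.List.Relation.Unary.Any using (Any)
open import Data.List.Relation.Binary.Permutation.Propositional using (_↭_)
open import Data.Vec using (Vec)
import Data.Vec as Vec
open import Data.Integer using (+_)
open import Data.Rational using (ℚ; _/_; 0ℚ)
open import Data.Product using (Σ; _×_)
open import Relation.Nullary using (¬_)
open import Relation.Binary.PropositionalEquality using (_≡_)

-- A hypergraph on the labeled vertex set V = {v_1,…,v_n}, vertex v_{i+1} ↔ (i : Fin n).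
-- The edge set E is given by a list of subsets of Fin n (E is the set of its members;
-- repetitions are immaterial).
record Hypergraph (n : ℕ) : Set where
  field
    edges         : List (Subset n)
    edgesNonempty : ¬ (edges ≡ [])
    edgeNonempty  : All Nonempty edges
open Hypergraph public

kmax : ∀ {n} → Hypergraph n → ℕ
kmax H = foldr (λ e m → ∣ e ∣ ⊔ m) 0 (edges H)

-- The (0-based) index tuple attached to a hyperedge e with s = |e| elements:
-- (i_1,…,i_s, n+s, …, n+k_max-1) in the paper's 1-based indexing, i.e. the vertex
-- indices of e followed by the 0-based indices n+s-1, …, n+k_max-2 of y_s,…,y_{k_max-1}.
edgeTuple : ∀ {n} → Hypergraph n → Subset n → List ℕ
edgeTuple {n} H e =
  map toℕ (filter (_∈? e) (allFin n))
  ++ applyUpTo (λ t → n + ∣ e ∣ ∸ 1 + t) (kmax H ∸ ∣ e ∣)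

-- A real (here rational-valued, all entries being rational) tensor of order k and dimension d.
record Tensor : Set where
  field
    order : ℕ
    dim   : ℕ
    entry : Vec (Fin dim) order → ℚ
open Tensor public

indexList : ∀ {d k} → Vec (Fin d) k → List ℕ
indexList idx = map toℕ (Vec.toList idx)

layeredValue : ℕ → ℚ
layeredValue k = (+ 1 / ((k ∸ 1) !)) {{(k ∸ 1) !≢0}}

IsLayeredAdjacencyTensor : ∀ {n} → Hypergraph n → Tensor → Set
IsLayeredAdjacencyTensor {n} H T =
  Σ (order T ≡ kmax H) λ _ →
  Σ (dim T ≡ n + kmax H ∸ 1) λ _ →
  (idx : Vec (Fin (dim T)) (order T)) →
    (Any (λ e → indexList idx ↭ edgeTuple H e) (edges H) → entry T idx ≡ layeredValue (kmax H))
    × (¬ Any (λ e → indexList idx ↭ edgeTuple H e) (edges H) → entry T idx ≡ 0ℚ)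

-- For a hyperedge e with s = |e| the edge tuple of e lists the vertex
-- indices of e (all < n) followed by padding indices n+s-1, …, n+k_max-2 (all ≥ n).
-- Hence the entries < n of the edge tuple are exactly the vertices of e, so two
-- nonempty edges whose tuples are permutations of each other coincide — even when
-- the tuples come from different hypergraphs.  If e is an edge of H, its edge tuple
-- is a legal index of the tensor (length k_max, entries < n+k_max-1), where the
-- tensor of H takes the nonzero value 1/(k_max-1)!.  Since the same tensor is the
-- tensor of H′, that index must be a permutation of the edge tuple of some edge
-- of H′, which is then e itself; so e ∈ E′, and symmetrically.
module Submission where

open import Defs
open import Data.Nat using (ℕ; _≥_; suc; _+_; _∸_; _⊔_; _≤_; _<_; _!)
open import Data.Nat.Properties
  using (≤-trans; m≤m+n; m≤n+m; m≤m⊔n; m≤n⊔m; m+[n∸m]≡n; +-∸-assoc; +-∸-comm; +-assoc;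
         +-monoʳ-<; <⇒≱; _!≢0)
open import Data.Bool.Properties using (_≟_)
open import Data.Fin using (Fin; toℕ; fromℕ<) renaming (zero to fzero; suc to fsuc)
open import Data.Fin.Properties using (toℕ<n; toℕ-injective; toℕ-fromℕ<)
import Data.Fin.Subset as S
open import Data.Fin.Subset using (Subset; inside; outside; Nonempty; ∣_∣)
open import Data.Fin.Subset.Properties
  using (_∈?_; ⊆-antisym; drop-there; p⊆q⇒∣p∣≤∣q∣; x∈⁅y⁆⇒x≡y; ∣⁅x⁆∣≡1)
open import Data.List using (List; []; _∷_; map; filter; allFin; applyUpTo; _++_; foldr; length; tabulate)
open import Data.List.Properties using (length-++; length-map; length-applyUpTo; filter-accept; filter-reject)
open import Data.List.Relation.Unary.All as All using (All; []; _∷_)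
open import Data.List.Relation.Unary.Any as Any using (Any; here; there)
open import Data.List.Membership.Propositional using (_∈_; find)
open import Data.List.Membership.Propositional.Properties
  using (∈-allFin; ∈-filter⁺; ∈-filter⁻; ∈-map⁺; ∈-map⁻; ∈-++⁺ˡ; ∈-++⁻; ∈-applyUpTo⁻)
open import Data.List.Relation.Binary.Permutation.Propositional using (_↭_; ↭-reflexive; ↭-sym)
open import Data.List.Relation.Binary.Permutation.Propositional.Properties using (∈-resp-↭)
open import Data.Vec using (Vec; []; _∷_)
import Data.Vec as Vec
open import Data.Vec.Properties using (≡-dec)
open import Data.Rational using (0ℚ; Positive)
open import Data.Rational.Properties using (normalize-pos)
open import Data.Product using (Σ; _,_; proj₁; proj₂)
open import Data.Sum using (inj₁; inj₂)
open import Data.Empty using (⊥-elim)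
open import Relation.Nullary using (¬_; yes; no)
open import Relation.Unary using (Decidable)
open import Relation.Binary.PropositionalEquality using (_≡_; refl; sym; trans; cong; cong₂; subst; module ≡-Reasoning)
open import Function using (_∘_)
open import Function.Bundles using (_⇔_; mk⇔; Equivalence)

open Equivalence using (to; from)

members : ∀ {n} → Subset n → List (Fin n)
members {n} e = filter (_∈? e) (allFin n)

tail-⇔ : ∀ {n a} {A : Set a} {s} {e : Subset n} {i : Fin n} → A ⇔ fsuc i S.∈ (s ∷ e) → A ⇔ i S.∈ e
tail-⇔ A⇔ = mk⇔ (drop-there ∘ to A⇔) (from A⇔ ∘ Vec.there)

-- Filtering a tabulated list by a predicate that holds at position i exactly when
-- i ∈ e keeps ∣ e ∣ elements.  (Stated for arbitrary tabulations so that the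
-- induction, which shifts f to f ∘ suc, goes through.)
length-filter-tabulate : ∀ {n b p} {B : Set b} {P : B → Set p} (P? : Decidable P)
  (e : Subset n) (f : Fin n → B) → (∀ i → P (f i) ⇔ i S.∈ e) →
  length (filter P? (tabulate f)) ≡ ∣ e ∣
length-filter-tabulate P? [] f _ = refl
length-filter-tabulate P? (inside ∷ e) f P⇔∈ =
  trans (cong length (filter-accept P? (from (P⇔∈ fzero) Vec.here)))
        (cong suc (length-filter-tabulate P? e (f ∘ fsuc) (tail-⇔ ∘ P⇔∈ ∘ fsuc)))
length-filter-tabulate P? (outside ∷ e) f P⇔∈ =
  trans (cong length (filter-reject P? (zero∉outside ∘ to (P⇔∈ fzero))))
        (length-filter-tabulate P? e (f ∘ fsuc) (tail-⇔ ∘ P⇔∈ ∘ fsuc))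
  where zero∉outside : ¬ (fzero S.∈ (outside ∷ e))
        zero∉outside ()

length-members : ∀ {n} (e : Subset n) → length (members e) ≡ ∣ e ∣
length-members e = length-filter-tabulate (_∈? e) e (λ i → i) (λ i → mk⇔ (λ p → p) (λ p → p))

nonempty⇒1≤∣e∣ : ∀ {n} {e : Subset n} → Nonempty e → 1 ≤ ∣ e ∣
nonempty⇒1≤∣e∣ {e = e} (i , i∈e) =
  subst (_≤ ∣ e ∣) (∣⁅x⁆∣≡1 i)
        (p⊆q⇒∣p∣≤∣q∣ (λ x∈⁅i⁆ → subst (S._∈ e) (sym (x∈⁅y⁆⇒x≡y i x∈⁅i⁆)) i∈e))

-- Arithmetic of the padding indices n+s-1+t (0-based) of an edge of size s ≥ 1:
-- they are at least n ...
n≤n+s∸1 : ∀ n {s} → 1 ≤ s → n ≤ n + s ∸ 1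
n≤n+s∸1 n {s} 1≤s = subst (n ≤_) (sym (+-∸-assoc n 1≤s)) (m≤m+n n (s ∸ 1))

-- ... and the padding of length k ∸ s ends exactly at the dimension n+k-1.
padding-end : ∀ n {s k} → 1 ≤ s → s ≤ k → n + s ∸ 1 + (k ∸ s) ≡ n + k ∸ 1
padding-end n {s} {k} 1≤s s≤k = begin
  n + s ∸ 1 + (k ∸ s)    ≡⟨ sym (+-∸-comm (k ∸ s) (≤-trans 1≤s (m≤n+m s n))) ⟩
  n + s + (k ∸ s) ∸ 1    ≡⟨ cong (_∸ 1) (+-assoc n s (k ∸ s)) ⟩
  n + (s + (k ∸ s)) ∸ 1  ≡⟨ cong (λ m → n + m ∸ 1) (m+[n∸m]≡n s≤k) ⟩
  n + k ∸ 1              ∎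
  where open ≡-Reasoning

∣e∣≤kmax : ∀ {n} (H : Hypergraph n) {e : Subset n} → e ∈ edges H → ∣ e ∣ ≤ kmax H
∣e∣≤kmax H = bound (edges H)
  where
  bound : ∀ {e} (es : List (Subset _)) → e ∈ es → ∣ e ∣ ≤ foldr (λ e m → ∣ e ∣ ⊔ m) 0 es
  bound (x ∷ es) (here refl) = m≤m⊔n ∣ x ∣ _
  bound (x ∷ es) (there e∈) = ≤-trans (bound es e∈) (m≤n⊔m ∣ x ∣ _)

module EdgeTuple {n : ℕ} (H : Hypergraph n) {e : Subset n} where

  private
    padding : List ℕ
    padding = applyUpTo (λ t → n + ∣ e ∣ ∸ 1 + t) (kmax H ∸ ∣ e ∣)

  vertex∈edgeTuple : ∀ {i} → i S.∈ e → toℕ i ∈ edgeTuple H e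
  vertex∈edgeTuple {i} i∈e = ∈-++⁺ˡ (∈-map⁺ toℕ (∈-filter⁺ (_∈? e) (∈-allFin i) i∈e))

  -- Conversely an index < n in the edge tuple is a vertex of e, because the
  -- padding indices are ≥ n.
  edgeTuple-vertex : Nonempty e → ∀ {i} → toℕ i ∈ edgeTuple H e → i S.∈ e
  edgeTuple-vertex ne {i} i∈ with ∈-++⁻ (map toℕ (members e)) i∈
  ... | inj₁ i∈vertices with ∈-map⁻ toℕ i∈vertices
  ...   | j , j∈members , i≡j rewrite toℕ-injective i≡j = proj₂ (∈-filter⁻ (_∈? e) {xs = allFin n} j∈members)
  edgeTuple-vertex ne {i} i∈ | inj₂ i∈padding with ∈-applyUpTo⁻ _ i∈padding
  ... | t , _ , i≡pad =
    ⊥-elim (<⇒≱ (toℕ<n i) (subst (n ≤_) (sym i≡pad)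
                             (≤-trans (n≤n+s∸1 n (nonempty⇒1≤∣e∣ ne)) (m≤m+n _ t))))

  length-edgeTuple : e ∈ edges H → length (edgeTuple H e) ≡ kmax H
  length-edgeTuple e∈E = begin
    length (map toℕ (members e) ++ padding)              ≡⟨ length-++ (map toℕ (members e)) ⟩
    length (map toℕ (members e)) + length padding        ≡⟨ cong₂ _+_ (trans (length-map toℕ (members e)) (length-members e))
                                                                     (length-applyUpTo _ (kmax H ∸ ∣ e ∣)) ⟩
    ∣ e ∣ + (kmax H ∸ ∣ e ∣)                             ≡⟨ m+[n∸m]≡n (∣e∣≤kmax H e∈E) ⟩
    kmax H                                               ∎
    where open ≡-Reasoning

  edgeTuple-bounded : e ∈ edges H → Nonempty e → All (_< n + kmax H ∸ 1) (edgeTuple H e)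
  edgeTuple-bounded e∈E ne = All.tabulate bounded
    where
    1≤s : 1 ≤ ∣ e ∣
    1≤s = nonempty⇒1≤∣e∣ ne
    s≤k : ∣ e ∣ ≤ kmax H
    s≤k = ∣e∣≤kmax H e∈E
    bounded : ∀ {x} → x ∈ edgeTuple H e → x < n + kmax H ∸ 1
    bounded x∈ with ∈-++⁻ (map toℕ (members e)) x∈
    ... | inj₁ x∈vertices with ∈-map⁻ toℕ x∈vertices
    ...   | j , _ , refl = ≤-trans (toℕ<n j) (n≤n+s∸1 n (≤-trans 1≤s s≤k))
    bounded x∈ | inj₂ x∈padding with ∈-applyUpTo⁻ _ x∈padding
    ... | t , t<k∸s , refl =
      subst (n + ∣ e ∣ ∸ 1 + t <_) (padding-end n 1≤s s≤k) (+-monoʳ-< (n + ∣ e ∣ ∸ 1) t<k∸s)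

open EdgeTuple

edgeTuple-injective : ∀ {n} (H H′ : Hypergraph n) {e e′ : Subset n} → Nonempty e → Nonempty e′ →
  edgeTuple H e ↭ edgeTuple H′ e′ → e ≡ e′
edgeTuple-injective H H′ ne ne′ σ =
  ⊆-antisym (edgeTuple-vertex H′ ne′ ∘ ∈-resp-↭ σ ∘ vertex∈edgeTuple H)
            (edgeTuple-vertex H ne ∘ ∈-resp-↭ (↭-sym σ) ∘ vertex∈edgeTuple H′)

listIndex : ∀ {d k} (l : List ℕ) → length l ≡ k → All (_< d) l →
  Σ (Vec (Fin d) k) (λ idx → indexList idx ≡ l)
listIndex [] refl [] = [] , refl
listIndex (x ∷ l) refl (x<d ∷ l<d) with listIndex l refl l<d
... | idx , idx≡l = fromℕ< x<d ∷ idx , cong₂ _∷_ (toℕ-fromℕ< x<d) idx≡l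

layeredValue≢0 : ∀ k → ¬ (layeredValue k ≡ 0ℚ)
layeredValue≢0 k value≡0 with subst Positive value≡0 (normalize-pos 1 ((k ∸ 1) !) {{(k ∸ 1) !≢0}})
... | ()

module _ {n : ℕ} (H H′ : Hypergraph n) where

  open import Data.List.Membership.DecPropositional (≡-dec {n = n} _≟_)
    using () renaming (_∈?_ to _∈ₑ?_)

  matching-edge⇒member : {e : Subset n} → Nonempty e →
    Any (λ x → edgeTuple H e ↭ edgeTuple H′ x) (edges H′) → e ∈ edges H′
  matching-edge⇒member ne match with find match
  ... | x , x∈E′ , σ =
    subst (_∈ edges H′) (sym (edgeTuple-injective H H′ ne (All.lookup (edgeNonempty H′) x∈E′) σ)) x∈E′

  -- Every edge of H is an edge of H′ when both have the same layered tensor: at the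
  -- index given by the edge tuple of e the common tensor is nonzero, which forces a
  -- matching edge of H′.
  edge⇒edge : (T : Tensor) → IsLayeredAdjacencyTensor H T → IsLayeredAdjacencyTensor H′ T →
    {e : Subset n} → e ∈ edges H → e ∈ edges H′
  edge⇒edge T (order≡ , dim≡ , entries) (_ , _ , entries′) {e} e∈E with e ∈ₑ? edges H′
  ... | yes e∈E′ = e∈E′
  ... | no e∉E′ = ⊥-elim (layeredValue≢0 (kmax H) (trans (sym onEdge) offEdges))
    where
    ne : Nonempty e
    ne = All.lookup (edgeNonempty H) e∈E
    index : Σ (Vec (Fin (dim T)) (order T)) (λ idx → indexList idx ≡ edgeTuple H e)
    index = listIndex (edgeTuple H e) (trans (length-edgeTuple H e∈E) (sym order≡))
                      (subst (λ d → All (_< d) (edgeTuple H e)) (sym dim≡) (edgeTuple-bounded H e∈E ne))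
    onEdge : entry T (proj₁ index) ≡ layeredValue (kmax H)
    onEdge = proj₁ (entries (proj₁ index)) (Any.map (λ { refl → ↭-reflexive (proj₂ index) }) e∈E)
    offEdges : entry T (proj₁ index) ≡ 0ℚ
    offEdges = proj₂ (entries′ (proj₁ index))
      (e∉E′ ∘ matching-edge⇒member ne ∘ Any.map (subst (_↭ _) (proj₂ index)))

mainTheorem5 : (n : ℕ) → n ≥ 1 → (H H′ : Hypergraph n) → (T : Tensor) →
    IsLayeredAdjacencyTensor H T → IsLayeredAdjacencyTensor H′ T →
    (e : Subset n) → (e ∈ edges H) ⇔ (e ∈ edges H′)
mainTheorem5 n _ H H′ T isTensor isTensor′ e =
  mk⇔ (edge⇒edge H H′ T isTensor isTensor′) (edge⇒edge H′ H T isTensor′ isTensor)
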